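{- Let $W_c$ be the set of all maximal pairs, and let $\phi,\psi\in\mathcal{L}$ be such that $\{(\Gamma,\Delta)\in W_c\mid\phi\in\Gamma\}=\{(\Gamma,\Delta)\in W_c\mid\psi\in\Gamma\}$. Then for every $(\Gamma',\Delta')\in W_c$ and every $\chi\in\mathcal{L}$: (1) $\phi\mathbin{\Box\!\!\to}\chi\in\Gamma'$ iff $\psi\mathbin{\Box\!\!\to}\chi\in\Gamma'$; (2) $\phi\mathbin{\Diamond\!\!\to}\chi\in\Gamma'$ iff $\psi\mathbin{\Diamond\!\!\to}\chi\in\Gamma'$.
   Context: $\mathcal{L}$ is built from propositional variables and $\top,\bot$ by $\wedge,\vee,\to$ and connectives $\phi\mathbin{\Box\!\!\to}\psi$, $\phi\mathbin{\Diamond\!\!\to}\psi$; $\neg\phi:=\phi\to\bot$. The Hilbert system $\mathbb{ICK}$ has axioms: (A0) all $\mathcal{L}$-instances of a complete axiomatization of intuitionistic propositional logic; (A1) $((\phi\mathbin{\Box\!\!\to}\psi)\wedge(\phi\mathbin{\Box\!\!\to}\chi))\leftrightarrow(\phi\mathbin{\Box\!\!\to}(\psi\wedge\chi))$; (A2) $((\phi\mathbin{\Diamond\!\!\to}\psi)\wedge(\phi\mathbin{\Box\!\!\to}\chi))\to(\phi\mathbin{\Diamond\!\!\to}(\psi\wedge\chi))$; (A3) $(\phi\mathbin{\Diamond\!\!\to}(\psi\vee\chi))\leftrightarrow((\phi\mathbin{\Diamond\!\!\to}\psi)\vee(\phi\mathbin{\Diamond\!\!\to}\chi))$; (A4) $((\phi\mathbin{\Diamond\!\!\to}\psi)\to(\phi\mathbin{\Box\!\!\to}\chi))\to(\phi\mathbin{\Box\!\!\to}(\psi\to\chi))$;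 (A5) $\phi\mathbin{\Box\!\!\to}\top$; (A6) $\neg(\phi\mathbin{\Diamond\!\!\to}\bot)$; rules: modus ponens; from $\phi\leftrightarrow\psi$ infer $(\phi\mathbin{\Box\!\!\to}\chi)\leftrightarrow(\psi\mathbin{\Box\!\!\to}\chi)$ and $(\chi\mathbin{\Box\!\!\to}\phi)\leftrightarrow(\chi\mathbin{\Box\!\!\to}\psi)$; and the same two with $\mathbin{\Diamond\!\!\to}$. $\Gamma\vdash\psi$ iff there is a finite sequence ending in $\psi$ each member of which is in $\Gamma$, a theorem of $\mathbb{ICK}$, or obtained from earlier members by modus ponens. A pair $(\Gamma,\Delta)$ of sets of formulas is consistent iff there is no finite $\Delta'\subseteq\Delta$ with $\Gamma\vdash\bigvee\Delta'$ ($\bigvee\emptyset=\bot$); complete iff $\Gamma\cup\Delta=\mathcal{L}$; maximal iff complete and consistent. -}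

module Defs where

open import Data.Nat using (ℕ)
open import Data.List using (List; []; _∷_)
open import Data.List.Relation.Unary.All using (All)
open import Data.Product using (_×_; ∃-syntax)
open import Data.Sum using (_⊎_)
open import Relation.Nullary using (¬_)
open import Relation.Unary using (Pred)
open import Level using (0ℓ)

infixr 6 _∧_
infixr 5 _∨_
infixr 4 _⇒_ _□→_ _◇→_ _↔′_

data Fm : Set where
  var   : ℕ → Fm
  ⊤′ ⊥′ : Fm
  _∧_ _∨_ _⇒_ : Fm → Fm → Fm
  _□→_ _◇→_   : Fm → Fm → Fm

¬′ : Fm → Fm
¬′ φ = φ ⇒ ⊥′

_↔′_ : Fm → Fm → Fm
φ ↔′ ψ = (φ ⇒ ψ) ∧ (ψ ⇒ φ)

-- (A0): a fixed complete Hilbert axiomatization of intuitionistic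
-- propositional logic (with ⊤, ⊥, ∧, ∨, →), all 𝓛-instances.
data IPCAx : Fm → Set where
  k    : ∀ φ ψ → IPCAx (φ ⇒ (ψ ⇒ φ))
  s    : ∀ φ ψ χ → IPCAx ((φ ⇒ (ψ ⇒ χ)) ⇒ ((φ ⇒ ψ) ⇒ (φ ⇒ χ)))
  ∧e₁  : ∀ φ ψ → IPCAx ((φ ∧ ψ) ⇒ φ)
  ∧e₂  : ∀ φ ψ → IPCAx ((φ ∧ ψ) ⇒ ψ)
  ∧i   : ∀ φ ψ → IPCAx (φ ⇒ (ψ ⇒ (φ ∧ ψ)))
  ∨i₁  : ∀ φ ψ → IPCAx (φ ⇒ (φ ∨ ψ))
  ∨i₂  : ∀ φ ψ → IPCAx (ψ ⇒ (φ ∨ ψ))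
  ∨e   : ∀ φ ψ χ → IPCAx ((φ ⇒ χ) ⇒ ((ψ ⇒ χ) ⇒ ((φ ∨ ψ) ⇒ χ)))
  ⊥e   : ∀ φ → IPCAx (⊥′ ⇒ φ)
  ⊤i   : IPCAx ⊤′

data Thm : Fm → Set where
  a0  : ∀ {φ} → IPCAx φ → Thm φ
  a1  : ∀ φ ψ χ → Thm (((φ □→ ψ) ∧ (φ □→ χ)) ↔′ (φ □→ (ψ ∧ χ)))
  a2  : ∀ φ ψ χ → Thm (((φ ◇→ ψ) ∧ (φ □→ χ)) ⇒ (φ ◇→ (ψ ∧ χ)))
  a3  : ∀ φ ψ χ → Thm ((φ ◇→ (ψ ∨ χ)) ↔′ ((φ ◇→ ψ) ∨ (φ ◇→ χ)))
  a4  : ∀ φ ψ χ → Thm (((φ ◇→ ψ) ⇒ (φ □→ χ)) ⇒ (φ □→ (ψ ⇒ χ)))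
  a5  : ∀ φ → Thm (φ □→ ⊤′)
  a6  : ∀ φ → Thm (¬′ (φ ◇→ ⊥′))
  mp  : ∀ {φ ψ} → Thm (φ ⇒ ψ) → Thm φ → Thm ψ
  re□ˡ : ∀ {φ ψ} χ → Thm (φ ↔′ ψ) → Thm ((φ □→ χ) ↔′ (ψ □→ χ))
  re□ʳ : ∀ {φ ψ} χ → Thm (φ ↔′ ψ) → Thm ((χ □→ φ) ↔′ (χ □→ ψ))
  re◇ˡ : ∀ {φ ψ} χ → Thm (φ ↔′ ψ) → Thm ((φ ◇→ χ) ↔′ (ψ ◇→ χ))
  re◇ʳ : ∀ {φ ψ} χ → Thm (φ ↔′ ψ) → Thm ((χ ◇→ φ) ↔′ (χ ◇→ ψ))

FmSet : Set₁
FmSet = Pred Fm 0ℓ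

data _⊢_ (Γ : FmSet) : Fm → Set where
  hyp : ∀ {φ} → Γ φ → Γ ⊢ φ
  thm : ∀ {φ} → Thm φ → Γ ⊢ φ
  mp  : ∀ {φ ψ} → Γ ⊢ (φ ⇒ ψ) → Γ ⊢ φ → Γ ⊢ ψ

⋁ : List Fm → Fm
⋁ []       = ⊥′
⋁ (φ ∷ φs) = φ ∨ ⋁ φs

Consistent : FmSet → FmSet → Set
Consistent Γ Δ = ¬ (∃[ Δ′ ] (All Δ Δ′ × (Γ ⊢ ⋁ Δ′)))

Complete : FmSet → FmSet → Set
Complete Γ Δ = ∀ φ → Γ φ ⊎ Δ φ

Maximal : FmSet → FmSet → Set
Maximal Γ Δ = Complete Γ Δ × Consistent Γ Δ

{-# OPTIONS --safe #-}

-- If φ and ψ lie in exactly the same maximal pairs, then φ ↔ ψ is a theorem: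
-- otherwise, say φ → ψ is not, the pair ({φ}, {ψ}) is consistent, and the
-- Lindenbaum construction (classical, and along an enumeration of 𝓛) extends
-- it to a maximal pair containing φ but not ψ. The replacement rules then
-- make φ □→ χ ↔ ψ □→ χ and φ ◇→ χ ↔ ψ ◇→ χ theorems, and maximal pairs are
-- deductively closed.

module Submission where

open import Defs
open import Axiom.ExcludedMiddle using (ExcludedMiddle)
open import Data.Empty using (⊥-elim)
open import Data.List using (List; []; _∷_; _++_; concatMap; cartesianProductWith)
open import Data.List.Membership.Propositional using (_∈_)
open import Data.List.Membership.Propositional.Properties
  using (∈-++⁺ˡ; ∈-++⁺ʳ; ∈-concatMap⁺; ∈-cartesianProductWith⁺)
open import Data.List.Relation.Binary.Subset.Propositional using () renaming (_⊆_ to _⊆ˡ_)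
open import Data.List.Relation.Unary.All as All using (All; []; _∷_)
open import Data.List.Relation.Unary.All.Properties using (++⁺)
open import Data.List.Relation.Unary.Any as Any using (here; there)
open import Data.Nat using (ℕ; zero; suc; _≤_; _≤′_; ≤′-refl; ≤′-step; _⊔_)
open import Data.Nat.Properties using (≤⇒≤′; m≤m⊔n; m≤n⊔m)
open import Data.Product using (_×_; _,_; proj₁; proj₂; ∃-syntax; uncurry)
open import Data.Sum using (_⊎_; inj₁; inj₂)
open import Function using (id; _∘_)
open import Function.Bundles using (_⇔_; mk⇔; Equivalence)
open import Level using (0ℓ)
open import Relation.Binary.PropositionalEquality using (refl)
open import Relation.Nullary using (¬_; yes; no)
open import Relation.Unary using (∅; ｛_｝; _∪_; _⊆_)

private
  variable
    Γ Γ′ Δ : FmSet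
    φ ψ θ x : Fm

⊢-mono : Γ ⊆ Γ′ → Γ ⊢ θ → Γ′ ⊢ θ
⊢-mono Γ⊆Γ′ (hyp θ∈Γ) = hyp (Γ⊆Γ′ θ∈Γ)
⊢-mono Γ⊆Γ′ (thm t)   = thm t
⊢-mono Γ⊆Γ′ (mp d e)  = mp (⊢-mono Γ⊆Γ′ d) (⊢-mono Γ⊆Γ′ e)

axiom : IPCAx φ → Γ ⊢ φ
axiom = thm ∘ a0

assumption : (Γ ∪ ｛ x ｝) ⊢ x
assumption = hyp (inj₂ refl)

⇒-refl : Γ ⊢ (φ ⇒ φ)
⇒-refl {φ = φ} = mp (mp (axiom (s φ (φ ⇒ φ) φ)) (axiom (k φ (φ ⇒ φ)))) (axiom (k φ φ))

deduction : (Γ ∪ ｛ x ｝) ⊢ θ → Γ ⊢ (x ⇒ θ)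
deduction {x = x} {θ} (hyp (inj₁ θ∈Γ)) = mp (axiom (k θ x)) (hyp θ∈Γ)
deduction             (hyp (inj₂ refl)) = ⇒-refl
deduction {x = x} {θ} (thm t)           = mp (axiom (k θ x)) (thm t)
deduction {x = x}     (mp {φ} {ψ} d e)  = mp (mp (axiom (s x φ ψ)) (deduction d)) (deduction e)

∨-introˡ : Γ ⊢ φ → Γ ⊢ (φ ∨ ψ)
∨-introˡ {φ = φ} {ψ} = mp (axiom (∨i₁ φ ψ))

∨-introʳ : Γ ⊢ ψ → Γ ⊢ (φ ∨ ψ)
∨-introʳ {ψ = ψ} {φ} = mp (axiom (∨i₂ φ ψ))

∨-elim : Γ ⊢ (φ ∨ ψ) → (Γ ∪ ｛ φ ｝) ⊢ θ → (Γ ∪ ｛ ψ ｝) ⊢ θ → Γ ⊢ θ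
∨-elim {φ = φ} {ψ} {θ} d e f = mp (mp (mp (axiom (∨e φ ψ θ)) (deduction e)) (deduction f)) d

explosion : Γ ⊢ ⊥′ → Γ ⊢ θ
explosion {θ = θ} = mp (axiom (⊥e θ))

⋁-++⁺ˡ : ∀ A B → Γ ⊢ ⋁ A → Γ ⊢ ⋁ (A ++ B)
⋁-++⁺ˡ []      B d = explosion d
⋁-++⁺ˡ (_ ∷ A) B d = ∨-elim d (∨-introˡ assumption) (∨-introʳ (⋁-++⁺ˡ A B assumption))

⋁-++⁺ʳ : ∀ A B → Γ ⊢ ⋁ B → Γ ⊢ ⋁ (A ++ B)
⋁-++⁺ʳ []      B d = d
⋁-++⁺ʳ (_ ∷ A) B d = ∨-introʳ (⋁-++⁺ʳ A B d)

⋁-split : ∀ B → All (Δ ∪ ｛ x ｝) B → Γ ⊢ ⋁ B → ∃[ B′ ] All Δ B′ × Γ ⊢ (x ∨ ⋁ B′)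
⋁-split []      []                d = [] , [] , ∨-introʳ d
⋁-split (b ∷ B) (inj₁ b∈Δ ∷ B⊆Δx) d with ⋁-split B B⊆Δx assumption
... | B′ , B′⊆Δ , x∨B′ =
  b ∷ B′ , b∈Δ ∷ B′⊆Δ ,
  ∨-elim d (∨-introʳ (∨-introˡ assumption))
           (∨-elim x∨B′ (∨-introˡ assumption) (∨-introʳ (∨-introʳ assumption)))
⋁-split (_ ∷ B) (inj₂ refl ∷ B⊆Δx) d with ⋁-split B B⊆Δx assumption
... | B′ , B′⊆Δ , x∨B′ = B′ , B′⊆Δ , ∨-elim d (∨-introˡ assumption) x∨B′

⋁-≡ : ∀ A → All ｛ ψ ｝ A → Γ ⊢ ⋁ A → Γ ⊢ ψ
⋁-≡ []      []          d = explosion d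
⋁-≡ (_ ∷ A) (refl ∷ A≡) d = ∨-elim d assumption (⋁-≡ A A≡ assumption)

∅-⊢⇒Thm : ∅ ⊢ θ → Thm θ
∅-⊢⇒Thm (thm t)  = t
∅-⊢⇒Thm (mp d e) = mp (∅-⊢⇒Thm d) (∅-⊢⇒Thm e)

Inconsistent : FmSet → FmSet → Set
Inconsistent Γ Δ = ∃[ Δ′ ] All Δ Δ′ × Γ ⊢ ⋁ Δ′

inconsistent-cut : Inconsistent (Γ ∪ ｛ x ｝) Δ → Inconsistent Γ (Δ ∪ ｛ x ｝) → Inconsistent Γ Δ
inconsistent-cut (A , A⊆Δ , x⊢A) (B , B⊆Δx , ⊢B) with ⋁-split B B⊆Δx ⊢B
... | B′ , B′⊆Δ , x∨B′ =
  A ++ B′ , ++⁺ A⊆Δ B′⊆Δ , ∨-elim x∨B′ (⋁-++⁺ˡ A B′ x⊢A) (⋁-++⁺ʳ A B′ assumption)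

consistent-extend : Consistent Γ Δ → ¬ Consistent (Γ ∪ ｛ x ｝) Δ → Consistent Γ (Δ ∪ ｛ x ｝)
consistent-extend c ¬c′ i = ¬c′ (λ i′ → c (inconsistent-cut i′ i))

maximal-closed : Maximal Γ Δ → Γ ⊢ θ → Γ θ
maximal-closed {θ = θ} (complete , consistent) d with complete θ
... | inj₁ θ∈Γ = θ∈Γ
... | inj₂ θ∈Δ = ⊥-elim (consistent (θ ∷ [] , θ∈Δ ∷ [] , ∨-introˡ d))

maximal-↔ : Maximal Γ Δ → Thm (φ ↔′ ψ) → Γ φ ⇔ Γ ψ
maximal-↔ M t = mk⇔ (λ φ∈Γ → maximal-closed M (mp (thm (mp (a0 (∧e₁ _ _)) t)) (hyp φ∈Γ)))
                    (λ ψ∈Γ → maximal-closed M (mp (thm (mp (a0 (∧e₂ _ _)) t)) (hyp ψ∈Γ)))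

binaryConnectives : List (Fm → Fm → Fm)
binaryConnectives = _∧_ ∷ _∨_ ∷ _⇒_ ∷ _□→_ ∷ _◇→_ ∷ []

stage : ℕ → List Fm
stage zero    = ⊤′ ∷ ⊥′ ∷ []
stage (suc n) =
  stage n ++ var n ∷ concatMap (λ _∙_ → cartesianProductWith _∙_ (stage n) (stage n)) binaryConnectives

stage-mono : ∀ {m n} → m ≤ n → stage m ⊆ˡ stage n
stage-mono = go ∘ ≤⇒≤′
  where
  go : ∀ {m n} → m ≤′ n → stage m ⊆ˡ stage n
  go ≤′-refl       = id
  go (≤′-step m≤n) = ∈-++⁺ˡ ∘ go m≤n

stage-binary : ∀ {_∙_ φ ψ} → _∙_ ∈ binaryConnectives →
               ∃[ m ] φ ∈ stage m → ∃[ n ] ψ ∈ stage n → ∃[ k ] (φ ∙ ψ) ∈ stage k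
stage-binary {_∙_} {φ} {ψ} ∙∈ (m , φ∈) (n , ψ∈) =
  suc l , ∈-++⁺ʳ (stage l) (there (∈-concatMap⁺ (λ _•_ → cartesianProductWith _•_ (stage l) (stage l))
                                                 (Any.map (λ { refl → φ∙ψ∈ }) ∙∈)))
  where
  l : ℕ
  l = m ⊔ n
  φ∙ψ∈ : (φ ∙ ψ) ∈ cartesianProductWith _∙_ (stage l) (stage l)
  φ∙ψ∈ = ∈-cartesianProductWith⁺ _∙_ (stage-mono (m≤m⊔n m n) φ∈) (stage-mono (m≤n⊔m m n) ψ∈)

stage-complete : ∀ θ → ∃[ n ] θ ∈ stage n
stage-complete (var j)  = suc j , ∈-++⁺ʳ (stage j) (here refl)
stage-complete ⊤′       = zero , here refl
stage-complete ⊥′       = zero , there (here refl)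
stage-complete (φ ∧ ψ)  = stage-binary (here refl) (stage-complete φ) (stage-complete ψ)
stage-complete (φ ∨ ψ)  = stage-binary (there (here refl)) (stage-complete φ) (stage-complete ψ)
stage-complete (φ ⇒ ψ)  = stage-binary (there (there (here refl))) (stage-complete φ) (stage-complete ψ)
stage-complete (φ □→ ψ) =
  stage-binary (there (there (there (here refl)))) (stage-complete φ) (stage-complete ψ)
stage-complete (φ ◇→ ψ) =
  stage-binary (there (there (there (there (here refl))))) (stage-complete φ) (stage-complete ψ)

Pair : Set₁
Pair = FmSet × FmSet

_⊑_ : Pair → Pair → Set
(Γ , Δ) ⊑ (Γ′ , Δ′) = Γ ⊆ Γ′ × Δ ⊆ Δ′

⊑-refl : ∀ {p} → p ⊑ p
⊑-refl = id , id

⊑-trans : ∀ {p q r} → p ⊑ q → q ⊑ r → p ⊑ r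
⊑-trans (Γ⊆ , Δ⊆) (Γ′⊆ , Δ′⊆) = Γ′⊆ ∘ Γ⊆ , Δ′⊆ ∘ Δ⊆

Decides : Fm → Pair → Set
Decides θ (Γ , Δ) = Γ θ ⊎ Δ θ

decides-mono : ∀ {p q} → p ⊑ q → Decides θ p → Decides θ q
decides-mono (Γ⊆ , Δ⊆) (inj₁ θ∈Γ) = inj₁ (Γ⊆ θ∈Γ)
decides-mono (Γ⊆ , Δ⊆) (inj₂ θ∈Δ) = inj₂ (Δ⊆ θ∈Δ)

module Union (S : ℕ → Pair) (S-step : ∀ n → S n ⊑ S (suc n)) where

  S-mono : ∀ {m n} → m ≤ n → S m ⊑ S n
  S-mono = go ∘ ≤⇒≤′
    where
    go : ∀ {m n} → m ≤′ n → S m ⊑ S n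
    go ≤′-refl            = ⊑-refl
    go (≤′-step {n} m≤n) = ⊑-trans (go m≤n) (S-step n)

  Γ∞ Δ∞ : FmSet
  Γ∞ θ = ∃[ n ] proj₁ (S n) θ
  Δ∞ θ = ∃[ n ] proj₂ (S n) θ

  ⊢-compact : Γ∞ ⊢ θ → ∃[ n ] proj₁ (S n) ⊢ θ
  ⊢-compact (hyp (n , θ∈)) = n , hyp θ∈
  ⊢-compact (thm t)        = 0 , thm t
  ⊢-compact (mp d e) with ⊢-compact d | ⊢-compact e
  ... | m , d′ | n , e′ = m ⊔ n , mp (⊢-mono (proj₁ (S-mono (m≤m⊔n m n))) d′)
                                     (⊢-mono (proj₁ (S-mono (m≤n⊔m m n))) e′)

  All-compact : ∀ {A} → All Δ∞ A → ∃[ n ] All (proj₂ (S n)) A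
  All-compact []             = 0 , []
  All-compact ((m , a∈) ∷ A⊆) with All-compact A⊆
  ... | n , A⊆′ =
    m ⊔ n , proj₂ (S-mono (m≤m⊔n m n)) a∈ ∷ All.map (proj₂ (S-mono (m≤n⊔m m n))) A⊆′

  union-consistent : (∀ n → uncurry Consistent (S n)) → Consistent Γ∞ Δ∞
  union-consistent S-consistent (A , A⊆ , ⊢A) with ⊢-compact ⊢A | All-compact A⊆
  ... | m , ⊢A′ | n , A⊆′ =
    S-consistent (m ⊔ n) (A , All.map (proj₂ (S-mono (m≤n⊔m m n))) A⊆′
                            , ⊢-mono (proj₁ (S-mono (m≤m⊔n m n))) ⊢A′)

  S⊑union : ∀ n → S n ⊑ (Γ∞ , Δ∞)
  S⊑union n = (n ,_) , (n ,_)

module Lindenbaum (em : ExcludedMiddle 0ℓ) where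

  step : Fm → Pair → Pair
  step x (Γ , Δ) with em {Consistent (Γ ∪ ｛ x ｝) Δ}
  ... | yes _ = Γ ∪ ｛ x ｝ , Δ
  ... | no _  = Γ , Δ ∪ ｛ x ｝

  step-⊒ : ∀ p → p ⊑ step x p
  step-⊒ {x} (Γ , Δ) with em {Consistent (Γ ∪ ｛ x ｝) Δ}
  ... | yes _ = inj₁ , id
  ... | no _  = id , inj₁

  step-decides : ∀ p → Decides x (step x p)
  step-decides {x} (Γ , Δ) with em {Consistent (Γ ∪ ｛ x ｝) Δ}
  ... | yes _ = inj₁ (inj₂ refl)
  ... | no _  = inj₂ (inj₂ refl)

  step-consistent : ∀ p → uncurry Consistent p → uncurry Consistent (step x p)
  step-consistent {x} (Γ , Δ) c with em {Consistent (Γ ∪ ｛ x ｝) Δ}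
  ... | yes c′ = c′
  ... | no ¬c′ = consistent-extend c ¬c′

  steps : List Fm → Pair → Pair
  steps []       p = p
  steps (x ∷ xs) p = steps xs (step x p)

  steps-⊒ : ∀ xs p → p ⊑ steps xs p
  steps-⊒ []       p = ⊑-refl
  steps-⊒ (x ∷ xs) p = ⊑-trans (step-⊒ p) (steps-⊒ xs (step x p))

  steps-decides : ∀ xs p → θ ∈ xs → Decides θ (steps xs p)
  steps-decides (x ∷ xs) p (here refl) = decides-mono (steps-⊒ xs (step x p)) (step-decides p)
  steps-decides (x ∷ xs) p (there θ∈) = steps-decides xs (step x p) θ∈

  steps-consistent : ∀ xs p → uncurry Consistent p → uncurry Consistent (steps xs p)
  steps-consistent []       p c = c
  steps-consistent (x ∷ xs) p c = steps-consistent xs (step x p) (step-consistent p c)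

  chain : Pair → ℕ → Pair
  chain p zero    = p
  chain p (suc n) = steps (stage n) (chain p n)

  lindenbaum : Consistent Γ Δ → ∃[ Γ′ ] ∃[ Δ′ ] Maximal Γ′ Δ′ × (Γ , Δ) ⊑ (Γ′ , Δ′)
  lindenbaum {Γ} {Δ} c = Γ∞ , Δ∞ , (complete , union-consistent chain-consistent) , S⊑union 0
    where
    open Union (chain (Γ , Δ)) (λ n → steps-⊒ (stage n) (chain (Γ , Δ) n))

    chain-consistent : ∀ n → uncurry Consistent (chain (Γ , Δ) n)
    chain-consistent zero    = c
    chain-consistent (suc n) = steps-consistent (stage n) _ (chain-consistent n)

    complete : Complete Γ∞ Δ∞
    complete θ with stage-complete θ
    ... | n , θ∈ = decides-mono (S⊑union (suc n)) (steps-decides (stage n) _ θ∈)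

valid⇒Thm : ExcludedMiddle 0ℓ → (∀ Γ Δ → Maximal Γ Δ → Γ φ → Γ ψ) → Thm (φ ⇒ ψ)
valid⇒Thm {φ} {ψ} em valid with em {Thm (φ ⇒ ψ)}
... | yes φ⇒ψ = φ⇒ψ
... | no ¬φ⇒ψ with Lindenbaum.lindenbaum em {｛ φ ｝} {｛ ψ ｝} φ⊬ψ
  where
  φ⊬ψ : Consistent ｛ φ ｝ ｛ ψ ｝
  φ⊬ψ (A , A≡ψ , ⊢A) = ¬φ⇒ψ (∅-⊢⇒Thm (deduction (⊢-mono inj₂ (⋁-≡ A A≡ψ ⊢A))))
... | Γ , Δ , M@(_ , consistent) , (φ⊆Γ , ψ⊆Δ) =
  ⊥-elim (consistent (ψ ∷ [] , ψ⊆Δ refl ∷ [] , ∨-introˡ (hyp (valid Γ Δ M (φ⊆Γ refl)))))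

lemma9 : ExcludedMiddle 0ℓ →
           (φ ψ : Fm) →
           (∀ (Γ Δ : FmSet) → Maximal Γ Δ → (Γ φ ⇔ Γ ψ)) →
           ∀ (Γ′ Δ′ : FmSet) → Maximal Γ′ Δ′ → ∀ (χ : Fm) →
           (Γ′ (φ □→ χ) ⇔ Γ′ (ψ □→ χ)) × (Γ′ (φ ◇→ χ) ⇔ Γ′ (ψ ◇→ χ))
lemma9 em φ ψ same Γ′ Δ′ M χ = maximal-↔ M (re□ˡ χ φ↔ψ) , maximal-↔ M (re◇ˡ χ φ↔ψ)
  where
  φ↔ψ : Thm (φ ↔′ ψ)
  φ↔ψ = mp (mp (a0 (∧i _ _)) (valid⇒Thm em (λ Γ Δ m → Equivalence.to   (same Γ Δ m))))
                             (valid⇒Thm em (λ Γ Δ m → Equivalence.from (same Γ Δ m)))
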